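{- If $S\in\widehat{\mathcal{S}}^{+}$ is cluster-positive, then $S$ satisfies (A), i.e. $\Gamma(S)$ contains a unique element satisfying (M1).
   Context: For $M=\begin{pmatrix} x & y & z\\ x' & y' & z'\end{pmatrix}$ with positive integer entries and $xyz=x'y'z'$, set $\mathrm{Sk}(M)=(\sqrt{xx'},\sqrt{yy'},\sqrt{zz'})$; $\widehat{\mathcal{S}}^{+}$ is the set of all such $\mathrm{Sk}(M)$. On triples $S=(p,q,r)$ the maps are $\gamma_1(S)=(qr-p,q,r)$, $\gamma_2(S)=(p,rp-q,r)$, $\gamma_3(S)=(p,q,pq-r)$; $\Gamma(S)$ is the set of images of $S$ under finite compositions $\gamma_{t_k}\cdots\gamma_{t_1}$ with $t_i\neq t_{i+1}$. A positive $S$ is cluster-positive if every element of $\Gamma(S)$ has all entries positive. With the entrywise order $\leq$, $S$ satisfies (M1) if $S\leq\gamma_i(S)$ for all $i=1,2,3$, and (M2) if this holds for precisely two $i$. Every cluster-positive $S$ satisfies either (A): $\Gamma(S)$ has a unique (M1) element, or (B): every element of $\Gamma(S)$ satisfies (M2). -}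

module Defs where

open import Data.Nat as ℕ using (ℕ; NonZero; >-nonZero)
open import Data.Nat.Properties using (m*n≢0)
open import Data.Integer using (+_)
open import Data.Rational using (ℚ; 0ℚ; 1ℚ; _+_; _*_; _-_; _≤_; _<_; _/_)
open import Data.Fin using (Fin; zero; suc)
open import Data.List using (List; []; _∷_)
open import Data.Product using (_×_; _,_; Σ; ∃; ∃-syntax)
open import Relation.Binary.PropositionalEquality using (_≡_)
open import Relation.Nullary using (¬_)

record Mat : Set where
  field
    x y z x' y' z' : ℕ
    x-pos  : 0 ℕ.< x
    y-pos  : 0 ℕ.< y
    z-pos  : 0 ℕ.< z
    x'-pos : 0 ℕ.< x'
    y'-pos : 0 ℕ.< y'
    z'-pos : 0 ℕ.< z'
    balanced : x ℕ.* y ℕ.* z ≡ x' ℕ.* y' ℕ.* z'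

-- Put a = xx', b = yy', c = zz', K = xyz (so abc = K²) and
-- Sk(M) = (√a, √b, √c).  Every triple reachable from Sk(M) by the maps
-- γ_i has the form (α√a, β√b, γ√c) with α, β, γ ∈ ℚ, because
--   √b·√c = K/√a = (K/a)·√a   (and cyclically).
-- We represent such a triple by its coefficient triple (α, β, γ).
-- Since √a, √b, √c > 0, this representation is injective, and order /
-- positivity of each real entry coincides with that of its coefficient.

Triple : Set
Triple = ℚ × ℚ × ℚ

data Reduced : List (Fin 3) → Set where
  nil  : Reduced []
  one  : ∀ t → Reduced (t ∷ [])
  cons : ∀ {s t w} → ¬ s ≡ t → Reduced (t ∷ w) → Reduced (s ∷ t ∷ w)

module _ (M : Mat) where
  open Mat M

  -- K / a = xyz / (xx'), etc.
  kA kB kC : ℚ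
  kA = _/_ (+ (x ℕ.* y ℕ.* z)) (x ℕ.* x')
    {{m*n≢0 x x' {{>-nonZero x-pos}} {{>-nonZero x'-pos}}}}
  kB = _/_ (+ (x ℕ.* y ℕ.* z)) (y ℕ.* y')
    {{m*n≢0 y y' {{>-nonZero y-pos}} {{>-nonZero y'-pos}}}}
  kC = _/_ (+ (x ℕ.* y ℕ.* z)) (z ℕ.* z')
    {{m*n≢0 z z' {{>-nonZero z-pos}} {{>-nonZero z'-pos}}}}

  -- Sk(M) = (√a, √b, √c), i.e. coefficients (1, 1, 1).
  Sk : Triple
  Sk = 1ℚ , 1ℚ , 1ℚ

  -- γ₁(p,q,r) = (qr − p, q, r), γ₂(p,q,r) = (p, rp − q, r),
  -- γ₃(p,q,r) = (p, q, pq − r), in coefficient form.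
  γ : Fin 3 → Triple → Triple
  γ zero             (α , β , δ) = ((β * δ) * kA - α , β , δ)
  γ (suc zero)       (α , β , δ) = (α , (δ * α) * kB - β , δ)
  γ (suc (suc zero)) (α , β , δ) = (α , β , (α * β) * kC - δ)

  -- apply w S = γ_{t_k} ⋯ γ_{t_1} S  for w = t_1 ∷ … ∷ t_k
  apply : List (Fin 3) → Triple → Triple
  apply []      S = S
  apply (t ∷ w) S = apply w (γ t S)

  _∈Γ_ : Triple → Triple → Set
  T ∈Γ S = ∃[ w ] (Reduced w × apply w S ≡ T)

  Positive : Triple → Set
  Positive (α , β , δ) = (0ℚ < α) × (0ℚ < β) × (0ℚ < δ)

  ClusterPositive : Triple → Set
  ClusterPositive S = Positive S × (∀ T → T ∈Γ S → Positive T)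

  _≤ₑ_ : Triple → Triple → Set
  (α , β , δ) ≤ₑ (α' , β' , δ') = (α ≤ α') × (β ≤ β') × (δ ≤ δ')

  M1 : Triple → Set
  M1 S = ∀ i → S ≤ₑ γ i S

  PropertyA : Triple → Set
  PropertyA S = ∃[ T ] ((T ∈Γ S × M1 T) × (∀ T' → T' ∈Γ S → M1 T' → T' ≡ T))

{-# OPTIONS --safe #-}
-- For an integer matrix N = (X Y Z ; X' Y' Z') with XYZ = X'Y'Z' put Sk N = (√(XX'), √(YY'), √(ZZ')).
-- The maps γᵢ lift to the matrix mutations X ↦ Y'Z' − X, X' ↦ YZ − X' (and cyclically), so Γ(Sk M)
-- consists of skeletons of matrices in the mutation orbit of M; in particular p², q², r² are integers
-- for every (p, q, r) in it.
-- Existence: while some γᵢ strictly lowers its entry, apply it; by cluster-positivity the top row stays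
-- a triple of positive integers, so this descent stops at an (M1) element.
-- Uniqueness: if γᵢ does not raise p (qr ≤ 2p) while γⱼ strictly lowers q (rp < 2q), then r² < 4, so
-- r² ∈ {1, 2, 3}, and alternating γᵢ and γⱼ then produces a non-positive entry within five steps
-- (the finite types A₂, B₂, G₂), contradicting cluster-positivity. Hence along a reduced path leaving
-- an (M1) element every step raises the entry it changes, and if the path ends at an (M1) element
-- every step fixes the triple.

module Submission where

open import Defs

open import Data.Empty using (⊥; ⊥-elim)
open import Data.Fin using (Fin)
open import Data.Fin.Patterns using (0F; 1F; 2F)
open import Data.Fin.Properties using (_≟_; all?; ¬∀⟶∃¬)
open import Data.Integer using (ℤ; +_; 0ℤ; ∣_∣; +<+)
open import Data.List using (List; []; _∷_; _++_; _ʳ++_)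
open import Data.Nat as ℕ using (ℕ; suc)
open import Data.Nat.Induction using (<-wellFounded)
import Data.Nat.Properties as ℕ
open import Data.Product using (_×_; _,_; proj₁; proj₂; ∃-syntax)
open import Data.Rational using (ℚ; _/_)
open import Data.Sum using (_⊎_; inj₁; inj₂)
open import Function using (_∘_)
open import Induction.WellFounded using (Acc; acc)
open import Relation.Binary.PropositionalEquality
open import Relation.Nullary using (¬_; Dec; yes; no)
open import Relation.Nullary.Decidable using (decidable-stable)

reduced-tail : ∀ {i w} → Reduced (i ∷ w) → Reduced w
reduced-tail (one _)    = nil
reduced-tail (cons _ r) = r

module ReducedWords {A : Set} (f : Fin 3 → A → A) (f-involutive : ∀ i a → f i (f i a) ≡ a) where

  act : List (Fin 3) → A → A
  act []      a = a
  act (i ∷ w) a = act w (f i a)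

  act-++ : ∀ u v a → act (u ++ v) a ≡ act v (act u a)
  act-++ []      v a = refl
  act-++ (i ∷ u) v a = act-++ u v (f i a)

  act-ʳ++ : ∀ u v a → act (u ʳ++ v) (act u a) ≡ act v a
  act-ʳ++ []      v a = refl
  act-ʳ++ (i ∷ u) v a = trans (act-ʳ++ u (i ∷ v) (f i a)) (cong (act v) (f-involutive i a))

  reduce : ∀ w a → ∃[ w′ ] (Reduced w′ × act w′ a ≡ act w a)
  reduce []      a = [] , nil , refl
  reduce (i ∷ w) a with reduce w (f i a)
  ... | [] , _ , eq = i ∷ [] , one i , eq
  ... | j ∷ w′ , red , eq with j ≟ i
  ...   | yes refl = w′ , reduced-tail red , trans (cong (act w′) (sym (f-involutive i a))) eq
  ...   | no j≢i   = i ∷ j ∷ w′ , cons (j≢i ∘ sym) red , eq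

  reduced-path : ∀ u v a → ∃[ w ] (Reduced w × act w (act u a) ≡ act v a)
  reduced-path u v a with reduce (u ʳ++ v) (act u a)
  ... | w , red , eq = w , red , trans eq (act-ʳ++ u v a)

module IntegerMatrices where

  open import Data.Integer
    using (_+_; _*_; _-_; -_; _≤_; _<_; _≤?_; +[1+_]; +0; positive; nonNegative; >-nonZero)
  open import Data.Integer.Properties
  open import Data.Integer.Tactic.RingSolver using (solve; solve-∀)
  open import Algebra.Properties.CommutativeSemigroup *-commutativeSemigroup
    using (xy∙z≈y∙zx; xy∙z≈z∙xy; xy∙z≈y∙xz; xy∙z≈yx∙z; xy∙z≈xz∙y; xy∙z≈zx∙y; xy∙z≈yz∙x; xy∙z≈zy∙x)
  open ≤-Reasoning

  record Matrix : Set where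
    constructor matrix
    field X Y Z X' Y' Z' : ℤ
  open Matrix public

  entry entry' partner partner' : Fin 3 → Matrix → ℤ
  entry 0F = X
  entry 1F = Y
  entry 2F = Z
  entry' 0F = X'
  entry' 1F = Y'
  entry' 2F = Z'
  partner 0F N = Y' N * Z' N
  partner 1F N = Z' N * X' N
  partner 2F N = X' N * Y' N
  partner' 0F N = Y N * Z N
  partner' 1F N = Z N * X N
  partner' 2F N = X N * Y N

  -- The matrix mutation over γᵢ: if XYZ = X'Y'Z' and Sk N = (p, q, r), then after mutate 0F the product
  -- XX' becomes Y'Z'YZ − XYZ − X'Y'Z' + XX' = (qr − p)², and cyclically.
  mutate : Fin 3 → Matrix → Matrix
  mutate 0F (matrix X Y Z X' Y' Z') = matrix (Y' * Z' - X) Y Z (Y * Z - X') Y' Z'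
  mutate 1F (matrix X Y Z X' Y' Z') = matrix X (Z' * X' - Y) Z X' (Z * X - Y') Z'
  mutate 2F (matrix X Y Z X' Y' Z') = matrix X Y (X' * Y' - Z) X' Y' (X * Y - Z')

  entry-mutate : ∀ i N → entry i (mutate i N) ≡ partner i N - entry i N
  entry-mutate 0F N = refl
  entry-mutate 1F N = refl
  entry-mutate 2F N = refl

  i-[i-j]≡j : ∀ a b → a - (a - b) ≡ b
  i-[i-j]≡j = solve-∀

  mutate-involutive : ∀ i N → mutate i (mutate i N) ≡ N
  mutate-involutive 0F (matrix X Y Z X' Y' Z') =
    cong₂ (λ a a' → matrix a Y Z a' Y' Z') (i-[i-j]≡j (Y' * Z') X) (i-[i-j]≡j (Y * Z) X')
  mutate-involutive 1F (matrix X Y Z X' Y' Z') =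
    cong₂ (λ b b' → matrix X b Z X' b' Z') (i-[i-j]≡j (Z' * X') Y) (i-[i-j]≡j (Z * X) Y')
  mutate-involutive 2F (matrix X Y Z X' Y' Z') =
    cong₂ (λ c c' → matrix X Y c X' Y' c') (i-[i-j]≡j (X' * Y') Z) (i-[i-j]≡j (X * Y) Z')

  open ReducedWords mutate mutate-involutive public

  EntriesPositive : Matrix → Set
  EntriesPositive N = ∀ i → 0ℤ < entry i N × 0ℤ < entry' i N

  OrbitPositive : Matrix → Set
  OrbitPositive N = ∀ w → EntriesPositive (act w N)

  act-orbit-positive : ∀ {N} u → OrbitPositive N → OrbitPositive (act u N)
  act-orbit-positive {N} u pos v = subst EntriesPositive (act-++ u v N) (pos (u ++ v))

  Rises Falls : Fin 3 → Matrix → Set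
  Rises i N = entry i N ≤ entry i (mutate i N)
  Falls i N = entry i (mutate i N) ≤ entry i N

  Minimal : Matrix → Set
  Minimal N = ∀ i → Rises i N

  rises? : ∀ i N → Dec (Rises i N)
  rises? i N = entry i N ≤? entry i (mutate i N)

  rises⇒falls-after : ∀ {i N} → Rises i N → Falls i (mutate i N)
  rises⇒falls-after {i} {N} rises =
    subst (λ N′ → entry i N′ ≤ entry i (mutate i N)) (sym (mutate-involutive i N)) rises

  -- For balanced N, norm i N is the square of the i-th entry of Sk N, and volume N is the product
  -- of its entries.
  norm : Fin 3 → Matrix → ℤ
  norm i N = entry i N * entry' i N

  volume : Matrix → ℤ
  volume N = X' N * Y' N * Z' N

  Balanced : Matrix → Set
  Balanced N = X N * Y N * Z N ≡ X' N * Y' N * Z' N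

  imbalance : Matrix → ℤ
  imbalance N = X N * Y N * Z N - X' N * Y' N * Z' N

  imbalance-mutate : ∀ i N → imbalance (mutate i N) ≡ - imbalance N
  imbalance-mutate 0F (matrix X Y Z X' Y' Z') = begin-equality
    (Y' * Z' - X) * Y * Z - (Y * Z - X') * Y' * Z' ≡⟨ solve (X ∷ Y ∷ Z ∷ X' ∷ Y' ∷ Z' ∷ []) ⟩
    - (X * Y * Z - X' * Y' * Z')                   ∎
  imbalance-mutate 1F (matrix X Y Z X' Y' Z') = begin-equality
    X * (Z' * X' - Y) * Z - X' * (Z * X - Y') * Z' ≡⟨ solve (X ∷ Y ∷ Z ∷ X' ∷ Y' ∷ Z' ∷ []) ⟩
    - (X * Y * Z - X' * Y' * Z')                   ∎
  imbalance-mutate 2F (matrix X Y Z X' Y' Z') = begin-equality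
    X * Y * (X' * Y' - Z) - X' * Y' * (X * Y - Z') ≡⟨ solve (X ∷ Y ∷ Z ∷ X' ∷ Y' ∷ Z' ∷ []) ⟩
    - (X * Y * Z - X' * Y' * Z')                   ∎

  mutate-balanced : ∀ i {N} → Balanced N → Balanced (mutate i N)
  mutate-balanced i {N} bal =
    i-j≡0⇒i≡j _ _ (trans (imbalance-mutate i N) (cong -_ (i≡j⇒i-j≡0 bal)))

  act-balanced : ∀ w {N} → Balanced N → Balanced (act w N)
  act-balanced []      bal = bal
  act-balanced (i ∷ w) bal = act-balanced w (mutate-balanced i bal)

  top-product : ∀ i N → X N * Y N * Z N ≡ entry i N * partner' i N
  top-product 0F N = *-assoc (X N) (Y N) (Z N)
  top-product 1F N = xy∙z≈y∙zx (X N) (Y N) (Z N)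
  top-product 2F N = xy∙z≈z∙xy (X N) (Y N) (Z N)

  bottom-product : ∀ i N → X' N * Y' N * Z' N ≡ entry' i N * partner i N
  bottom-product 0F N = *-assoc (X' N) (Y' N) (Z' N)
  bottom-product 1F N = xy∙z≈y∙zx (X' N) (Y' N) (Z' N)
  bottom-product 2F N = xy∙z≈z∙xy (X' N) (Y' N) (Z' N)

  balanced-at : ∀ i {N} → Balanced N → entry i N * partner' i N ≡ entry' i N * partner i N
  balanced-at i {N} bal = trans (sym (top-product i N)) (trans bal (bottom-product i N))

  product-entry : ∀ i {N} → Balanced N → X N * Y N * Z N * entry i N ≡ partner i N * norm i N
  product-entry i {N} bal = begin-equality
    X N * Y N * Z N * entry i N          ≡⟨ cong (_* entry i N) (trans bal (bottom-product i N)) ⟩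
    entry' i N * partner i N * entry i N ≡⟨ xy∙z≈y∙zx (entry' i N) (partner i N) (entry i N) ⟩
    partner i N * norm i N               ∎

  product-entry' : ∀ i N → X N * Y N * Z N * entry' i N ≡ partner' i N * norm i N
  product-entry' i N = begin-equality
    X N * Y N * Z N * entry' i N          ≡⟨ cong (_* entry' i N) (top-product i N) ⟩
    entry i N * partner' i N * entry' i N ≡⟨ xy∙z≈y∙xz (entry i N) (partner' i N) (entry' i N) ⟩
    partner' i N * norm i N               ∎

  mutate-fixed : ∀ i {N} → entry i (mutate i N) ≡ entry i N → partner' i N - entry' i N ≡ entry' i N →
    mutate i N ≡ N
  mutate-fixed 0F {N} = cong₂ (λ a a' → matrix a (Y N) (Z N) a' (Y' N) (Z' N))
  mutate-fixed 1F {N} = cong₂ (λ b b' → matrix (X N) b (Z N) (X' N) b' (Z' N))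
  mutate-fixed 2F {N} = cong₂ (λ c c' → matrix (X N) (Y N) c (X' N) (Y' N) c')

  exchange-fixed : ∀ a a' p q → 0ℤ < a → a * q ≡ a' * p → p - a ≡ a → q - a' ≡ a'
  exchange-fixed a a' p q a>0 aq≡a'p p-a≡a = *-cancelˡ-≡ a (q - a') a' {{>-nonZero a>0}} (begin-equality
    a * (q - a')    ≡⟨ solve (a ∷ a' ∷ q ∷ []) ⟩
    a * q - a * a'  ≡⟨ cong (_- a * a') aq≡a'p ⟩
    a' * p - a * a' ≡⟨ solve (a ∷ a' ∷ p ∷ []) ⟩
    a' * (p - a)    ≡⟨ cong (a' *_) p-a≡a ⟩
    a' * a          ≡⟨ *-comm a' a ⟩
    a * a'          ∎)

  top-fixed⇒fixed : ∀ i {N} → Balanced N → 0ℤ < entry i N → entry i (mutate i N) ≡ entry i N → mutate i N ≡ N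
  top-fixed⇒fixed i {N} bal pos fixed = mutate-fixed i fixed bottom-fixed
    where
    bottom-fixed : partner' i N - entry' i N ≡ entry' i N
    bottom-fixed = exchange-fixed (entry i N) (entry' i N) (partner i N) (partner' i N)
      pos (balanced-at i bal) (trans (sym (entry-mutate i N)) fixed)

  pos*pos : ∀ {i j} → 0ℤ < i → 0ℤ < j → 0ℤ < i * j
  pos*pos {+[1+ _ ]} {+[1+ _ ]} _        _        = +<+ (ℕ.s≤s ℕ.z≤n)
  pos*pos {+0}                  (+<+ ()) _
  pos*pos {+[1+ _ ]} {+0}       _        (+<+ ())

  scale-≤ : ∀ {a c p} → 0ℤ < c → p - a ≤ a → c * p ≤ a * c + a * c
  scale-≤ {a} {c} {p} c>0 p-a≤a = begin
    c * p           ≡⟨ solve (a ∷ c ∷ p ∷ []) ⟩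
    c * (p - a + a) ≤⟨ *-monoˡ-≤-nonNeg c {{nonNegative (<⇒≤ c>0)}} (+-monoˡ-≤ a p-a≤a) ⟩
    c * (a + a)     ≡⟨ solve (a ∷ c ∷ []) ⟩
    a * c + a * c   ∎

  scale-< : ∀ {a c p} → 0ℤ < c → p - a < a → c * p < a * c + a * c
  scale-< {a} {c} {p} c>0 p-a<a = begin-strict
    c * p           ≡⟨ solve (a ∷ c ∷ p ∷ []) ⟩
    c * (p - a + a) <⟨ *-monoˡ-<-pos c {{positive c>0}} (+-monoˡ-< a p-a<a) ⟩
    c * (a + a)     ≡⟨ solve (a ∷ c ∷ []) ⟩
    a * c + a * c   ∎

  falls⇒volume≤ : ∀ i {N} → 0ℤ < entry' i N → Falls i N → volume N ≤ norm i N + norm i N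
  falls⇒volume≤ i {N} pos falls = subst (_≤ norm i N + norm i N) (sym (bottom-product i N))
    (scale-≤ pos (subst (_≤ entry i N) (entry-mutate i N) falls))

  drops⇒volume< : ∀ i {N} → 0ℤ < entry' i N → ¬ Rises i N → volume N < norm i N + norm i N
  drops⇒volume< i {N} pos drops = subst (_< norm i N + norm i N) (sym (bottom-product i N))
    (scale-< pos (subst (_< entry i N) (entry-mutate i N) (≰⇒> drops)))

  volume² : ∀ {N} → Balanced N → volume N * volume N ≡ norm 0F N * norm 1F N * norm 2F N
  volume² {matrix X Y Z X' Y' Z'} bal = begin-equality
    X' * Y' * Z' * (X' * Y' * Z') ≡⟨ cong (_* (X' * Y' * Z')) bal ⟨
    X * Y * Z * (X' * Y' * Z')    ≡⟨ solve (X ∷ Y ∷ Z ∷ X' ∷ Y' ∷ Z' ∷ []) ⟩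
    X * X' * (Y * Y') * (Z * Z')  ∎

  -- With V = pqr, a = p², b = q², c = r²: pqr ≤ 2p² and pqr < 2q² force r² < 4.
  fall-drop-bound : ∀ {V a b c} → 0ℤ < V → 0ℤ < a → 0ℤ < b →
    V ≤ a + a → V < b + b → V * V ≡ a * b * c → c < + 4
  fall-drop-bound {V} {a} {b} {c} V>0 a>0 b>0 V≤2a V<2b V²≡abc =
    *-cancelˡ-<-nonNeg (a * b) {{nonNegative (<⇒≤ (pos*pos a>0 b>0))}} (begin-strict
      a * b * c         ≡⟨ V²≡abc ⟨
      V * V             ≤⟨ *-monoʳ-≤-nonNeg V {{nonNegative (<⇒≤ V>0)}} V≤2a ⟩
      (a + a) * V       <⟨ *-monoˡ-<-pos (a + a) {{positive (+-mono-< a>0 a>0)}} V<2b ⟩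
      (a + a) * (b + b) ≡⟨ solve (a ∷ b ∷ []) ⟩
      a * b * + 4       ∎)

  norm-positive : ∀ {N} → EntriesPositive N → ∀ i → 0ℤ < norm i N
  norm-positive pos i = pos*pos (proj₁ (pos i)) (proj₂ (pos i))

  volume-positive : ∀ {N} → EntriesPositive N → 0ℤ < volume N
  volume-positive pos = pos*pos (pos*pos (proj₂ (pos 0F)) (proj₂ (pos 1F))) (proj₂ (pos 2F))

  third-norm<4 : ∀ i j k {N} → EntriesPositive N → Falls i N → ¬ Rises j N →
    volume N * volume N ≡ norm i N * norm j N * norm k N → norm k N < + 4
  third-norm<4 i j k pos falls drops = fall-drop-bound (volume-positive pos)
    (norm-positive pos i) (norm-positive pos j)
    (falls⇒volume≤ i (proj₂ (pos i)) falls) (drops⇒volume< j (proj₂ (pos j)) drops)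

  volume²-permuted : ∀ {N} {f : ℤ → ℤ → ℤ → ℤ} → Balanced N → (∀ a b c → a * b * c ≡ f a b c) →
    volume N * volume N ≡ f (norm 0F N) (norm 1F N) (norm 2F N)
  volume²-permuted {N} bal σ = trans (volume² {N} bal) (σ (norm 0F N) (norm 1F N) (norm 2F N))

  some-norm<4 : ∀ i j {N} → Balanced N → EntriesPositive N → Falls i N → ¬ Rises j N → i ≢ j →
    ∃[ k ] norm k N < + 4
  some-norm<4 0F 0F _   _   _ _ i≢j = ⊥-elim (i≢j refl)
  some-norm<4 1F 1F _   _   _ _ i≢j = ⊥-elim (i≢j refl)
  some-norm<4 2F 2F _   _   _ _ i≢j = ⊥-elim (i≢j refl)
  some-norm<4 0F 1F {N} bal pos f d _ = 2F , third-norm<4 0F 1F 2F pos f d (volume² {N} bal)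
  some-norm<4 1F 0F {N} bal pos f d _ = 2F , third-norm<4 1F 0F 2F pos f d (volume²-permuted {N} bal xy∙z≈yx∙z)
  some-norm<4 0F 2F {N} bal pos f d _ = 1F , third-norm<4 0F 2F 1F pos f d (volume²-permuted {N} bal xy∙z≈xz∙y)
  some-norm<4 2F 0F {N} bal pos f d _ = 1F , third-norm<4 2F 0F 1F pos f d (volume²-permuted {N} bal xy∙z≈zx∙y)
  some-norm<4 1F 2F {N} bal pos f d _ = 0F , third-norm<4 1F 2F 0F pos f d (volume²-permuted {N} bal xy∙z≈yz∙x)
  some-norm<4 2F 1F {N} bal pos f d _ = 0F , third-norm<4 2F 1F 0F pos f d (volume²-permuted {N} bal xy∙z≈zy∙x)

  below-4 : ∀ {s} → 0ℤ < s → s < + 4 → s ≡ + 1 ⊎ s ≡ + 2 ⊎ s ≡ + 3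
  below-4 {+0}     (+<+ ()) _
  below-4 {+ 1}    _ _ = inj₁ refl
  below-4 {+ 2}    _ _ = inj₂ (inj₁ refl)
  below-4 {+ 3}    _ _ = inj₂ (inj₂ refl)
  below-4 {+ suc (suc (suc (suc _)))} _ (+<+ (ℕ.s≤s (ℕ.s≤s (ℕ.s≤s (ℕ.s≤s ())))))

  neg-pos⇒⊥ : ∀ {i} → 0ℤ < i → 0ℤ < - i → ⊥
  neg-pos⇒⊥ i>0 -i>0 = <-asym (neg-mono-< i>0) -i>0

  -- The entries u, v changed by alternately applying the two mutations that keep the pair (r, r').
  -- For rr' = 1, 2, 3 (the rank 2 finite types A₂, B₂, G₂) one of them turns negative.
  module Alternation (u v r r' : ℤ) where

    u₁ v₁ u₂ v₂ u₃ : ℤ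
    u₁ = v * r' - u
    v₁ = r * u₁ - v
    u₂ = v₁ * r' - u₁
    v₂ = r * u₂ - v₁
    u₃ = v₂ * r' - u₂

    v₁-at-1 : r * r' ≡ + 1 → v₁ ≡ - (r * u)
    v₁-at-1 rr'≡1 = begin-equality
      r * (v * r' - u) - v      ≡⟨ solve (u ∷ v ∷ r ∷ r' ∷ []) ⟩
      v * (r * r') - r * u - v  ≡⟨ cong (λ s → v * s - r * u - v) rr'≡1 ⟩
      v * + 1 - r * u - v       ≡⟨ solve (u ∷ v ∷ r ∷ []) ⟩
      - (r * u)                 ∎

    u₂-at-2 : r * r' ≡ + 2 → u₂ ≡ - u
    u₂-at-2 rr'≡2 = begin-equality
      (r * (v * r' - u) - v) * r' - (v * r' - u)
        ≡⟨ solve (u ∷ v ∷ r ∷ r' ∷ []) ⟩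
      (r * r' - + 2) * (v * r') - (r * r' - + 1) * u
        ≡⟨ cong (λ s → (s - + 2) * (v * r') - (s - + 1) * u) rr'≡2 ⟩
      (+ 2 - + 2) * (v * r') - (+ 2 - + 1) * u
        ≡⟨ solve (u ∷ v ∷ r' ∷ []) ⟩
      - u ∎

    u₃-at-3 : r * r' ≡ + 3 → u₃ ≡ - u
    u₃-at-3 rr'≡3 = begin-equality
      (r * ((r * (v * r' - u) - v) * r' - (v * r' - u)) - (r * (v * r' - u) - v)) * r'
        - ((r * (v * r' - u) - v) * r' - (v * r' - u))
        ≡⟨ solve (u ∷ v ∷ r ∷ r' ∷ []) ⟩
      (r * r' - + 1) * (r * r' - + 3) * (v * r') - (r * r' * (r * r' - + 3) + + 1) * u
        ≡⟨ cong (λ s → (s - + 1) * (s - + 3) * (v * r') - (s * (s - + 3) + + 1) * u) rr'≡3 ⟩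
      (+ 3 - + 1) * (+ 3 - + 3) * (v * r') - (+ 3 * (+ 3 - + 3) + + 1) * u
        ≡⟨ solve (u ∷ v ∷ r' ∷ []) ⟩
      - u ∎

    4≤rr' : 0ℤ < u → 0ℤ < r → 0ℤ < r' → 0ℤ < v₁ → 0ℤ < u₂ → 0ℤ < u₃ → + 4 ≤ r * r'
    4≤rr' u>0 r>0 r'>0 v₁>0 u₂>0 u₃>0 = ≮⇒≥ λ rr'<4 → case (below-4 (pos*pos r>0 r'>0) rr'<4)
      where
      case : r * r' ≡ + 1 ⊎ r * r' ≡ + 2 ⊎ r * r' ≡ + 3 → ⊥
      case (inj₁ rr'≡1)        = neg-pos⇒⊥ (pos*pos r>0 u>0) (subst (0ℤ <_) (v₁-at-1 rr'≡1) v₁>0)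
      case (inj₂ (inj₁ rr'≡2)) = neg-pos⇒⊥ u>0 (subst (0ℤ <_) (u₂-at-2 rr'≡2) u₂>0)
      case (inj₂ (inj₂ rr'≡3)) = neg-pos⇒⊥ u>0 (subst (0ℤ <_) (u₃-at-3 rr'≡3) u₃>0)

  module _ {N : Matrix} (pos : OrbitPositive N) where

    private
      top : ∀ i w → 0ℤ < entry i (act w N)
      top i w = proj₁ (pos w i)

      bottom : ∀ i w → 0ℤ < entry' i (act w N)
      bottom i w = proj₂ (pos w i)

    4≤norm : ∀ k → + 4 ≤ norm k N
    4≤norm 0F = Alternation.4≤rr' (Y N) (Z' N) (X N) (X' N) (top 1F []) (top 0F []) (bottom 0F [])
      (bottom 2F (1F ∷ 2F ∷ [])) (top 1F (1F ∷ 2F ∷ 1F ∷ [])) (top 1F (1F ∷ 2F ∷ 1F ∷ 2F ∷ 1F ∷ []))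
    4≤norm 1F = Alternation.4≤rr' (Z N) (X' N) (Y N) (Y' N) (top 2F []) (top 1F []) (bottom 1F [])
      (bottom 0F (2F ∷ 0F ∷ [])) (top 2F (2F ∷ 0F ∷ 2F ∷ [])) (top 2F (2F ∷ 0F ∷ 2F ∷ 0F ∷ 2F ∷ []))
    4≤norm 2F = Alternation.4≤rr' (X N) (Y' N) (Z N) (Z' N) (top 0F []) (top 2F []) (bottom 2F [])
      (bottom 1F (0F ∷ 1F ∷ [])) (top 0F (0F ∷ 1F ∷ 0F ∷ [])) (top 0F (0F ∷ 1F ∷ 0F ∷ 1F ∷ 0F ∷ []))

  falls⇒rises : ∀ {N i j} → Balanced N → OrbitPositive N → Falls i N → i ≢ j → Rises j N
  falls⇒rises {N} {i} {j} bal pos falls i≢j = decidable-stable (rises? j N) λ drops →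
    let k , small = some-norm<4 i j bal (pos []) falls drops i≢j
    in <⇒≱ small (4≤norm pos k)

  rises-into-minimal⇒fixed : ∀ {N j} → Balanced N → OrbitPositive N → Rises j N → Minimal (mutate j N) →
    mutate j N ≡ N
  rises-into-minimal⇒fixed {N} {j} bal pos rises min = trans (sym fixed) (mutate-involutive j N)
    where
    fixed : mutate j (mutate j N) ≡ mutate j N
    fixed = top-fixed⇒fixed j (mutate-balanced j bal) (proj₁ (pos (j ∷ []) j))
      (≤-antisym (rises⇒falls-after {j} {N} rises) (min j))

  rising-path-stationary : ∀ {N j w} → Balanced N → OrbitPositive N → Rises j N → Reduced (j ∷ w) →
    Minimal (act (j ∷ w) N) → act (j ∷ w) N ≡ N
  rising-path-stationary bal pos rises (one _) min = rises-into-minimal⇒fixed bal pos rises min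
  rising-path-stationary {N} {j} {k ∷ w} bal pos rises (cons j≢k reduced) min =
    trans moved (rises-into-minimal⇒fixed bal pos rises (subst Minimal moved min))
    where
    moved : act (k ∷ w) (mutate j N) ≡ mutate j N
    moved = rising-path-stationary (mutate-balanced j bal) (pos ∘ (j ∷_))
      (falls⇒rises (mutate-balanced j bal) (pos ∘ (j ∷_)) (rises⇒falls-after {j} {N} rises) j≢k)
      reduced min

  minimal-path-stationary : ∀ {N} w → Balanced N → OrbitPositive N → Minimal N → Reduced w →
    Minimal (act w N) → act w N ≡ N
  minimal-path-stationary []      _   _   _   _       _    = refl
  minimal-path-stationary (j ∷ w) bal pos min reduced min′ =
    rising-path-stationary bal pos (min j) reduced min′

  minimal-unique : ∀ {N} u v → Balanced N → OrbitPositive N → Minimal (act u N) → Minimal (act v N) →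
    act u N ≡ act v N
  minimal-unique {N} u v bal pos min-u min-v with reduced-path u v N
  ... | w , reduced , path = trans (sym stationary) path
    where
    stationary : act w (act u N) ≡ act u N
    stationary = minimal-path-stationary w (act-balanced u bal) (act-orbit-positive u pos) min-u reduced
      (subst Minimal (sym path) min-v)

  size : Matrix → ℕ
  size N = ∣ X N ∣ ℕ.+ ∣ Y N ∣ ℕ.+ ∣ Z N ∣

  ∣∣-mono-< : ∀ {i j} → 0ℤ < i → i < j → ∣ i ∣ ℕ.< ∣ j ∣
  ∣∣-mono-< {+ _} {+ _} _ (+<+ i<j) = i<j

  drops-shrink : ∀ i N → 0ℤ < entry i (mutate i N) → ¬ Rises i N → size (mutate i N) ℕ.< size N
  drops-shrink 0F N pos drops = ℕ.+-monoˡ-< ∣ Z N ∣ (ℕ.+-monoˡ-< ∣ Y N ∣ (∣∣-mono-< pos (≰⇒> drops)))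
  drops-shrink 1F N pos drops = ℕ.+-monoˡ-< ∣ Z N ∣ (ℕ.+-monoʳ-< ∣ X N ∣ (∣∣-mono-< pos (≰⇒> drops)))
  drops-shrink 2F N pos drops = ℕ.+-monoʳ-< (∣ X N ∣ ℕ.+ ∣ Y N ∣) (∣∣-mono-< pos (≰⇒> drops))

  minimal-or-drop : ∀ N → Minimal N ⊎ ∃[ i ] ¬ Rises i N
  minimal-or-drop N with all? (λ i → rises? i N)
  ... | yes min  = inj₁ min
  ... | no ¬min = inj₂ (¬∀⟶∃¬ 3 _ (λ i → rises? i N) ¬min)

  descend : ∀ N → OrbitPositive N → Acc ℕ._<_ (size N) → ∃[ w ] Minimal (act w N)
  descend N pos (acc smaller) with minimal-or-drop N
  ... | inj₁ min = [] , min
  ... | inj₂ (i , drops)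
    with descend (mutate i N) (pos ∘ (i ∷_)) (smaller (drops-shrink i N (proj₁ (pos (i ∷ []) i)) drops))
  ...   | w , min = i ∷ w , min

  minimal-reachable : ∀ {N} → OrbitPositive N → ∃[ w ] (Reduced w × Minimal (act w N))
  minimal-reachable {N} pos with descend N pos (<-wellFounded (size N))
  ... | w , min with reduce w N
  ...   | w′ , reduced , path = w′ , reduced , subst Minimal (sym path) min

open IntegerMatrices

module Embedding where

  import Data.Integer as ℤ
  import Data.Integer.Properties as ℤ
  open import Data.Integer.Tactic.RingSolver using (solve-∀)
  open import Data.Rational using (0ℚ; positive; _+_; _*_; _-_; -_; _≤_; _<_; *≤*; *<*)
  open import Data.Rational.Literals using (fromℤ)
  open import Data.Rational.Properties
    using (≤-antisym; ≤-reflexive; *-cancelʳ-≤-pos; +-*-commutativeRing;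
           toℚᵘ-injective; toℚᵘ-homo-*; toℚᵘ-homo-+; toℚᵘ-fromℚᵘ)
  import Data.Rational.Unnormalised as ℚᵘ
  import Data.Rational.Unnormalised.Properties as ℚᵘ
  open import Data.Maybe using (nothing)
  open import Level using (0ℓ)
  open import Tactic.RingSolver.Core.AlmostCommutativeRing using (AlmostCommutativeRing; fromCommutativeRing)
  import Tactic.RingSolver as RS
  open ≡-Reasoning

  fromℤ-homo-* : ∀ i j → fromℤ (i ℤ.* j) ≡ fromℤ i * fromℤ j
  fromℤ-homo-* i j =
    toℚᵘ-injective (ℚᵘ.≃-sym (ℚᵘ.≃-trans (toℚᵘ-homo-* (fromℤ i) (fromℤ j)) (ℚᵘ.*≡* refl)))

  fromℤ-homo-+ : ∀ i j → fromℤ (i ℤ.+ j) ≡ fromℤ i + fromℤ j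
  fromℤ-homo-+ i j =
    toℚᵘ-injective (ℚᵘ.≃-sym (ℚᵘ.≃-trans (toℚᵘ-homo-+ (fromℤ i) (fromℤ j)) (ℚᵘ.*≡* (eq i j))))
    where
    eq : ∀ i j → (i ℤ.* ℤ.+ 1 ℤ.+ j ℤ.* ℤ.+ 1) ℤ.* ℤ.+ 1 ≡ (i ℤ.+ j) ℤ.* ℤ.+ 1
    eq = solve-∀

  fromℤ-homo‿- : ∀ i → fromℤ (ℤ.- i) ≡ - fromℤ i
  fromℤ-homo‿- ℤ.+0       = refl
  fromℤ-homo‿- ℤ.+[1+ _ ] = refl
  fromℤ-homo‿- ℤ.-[1+ _ ] = refl

  fromℤ-homo-minus : ∀ i j → fromℤ (i ℤ.- j) ≡ fromℤ i - fromℤ j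
  fromℤ-homo-minus i j = trans (fromℤ-homo-+ i (ℤ.- j)) (cong (λ q → fromℤ i + q) (fromℤ-homo‿- j))

  fromℤ-mono-≤ : ∀ {i j} → i ℤ.≤ j → fromℤ i ≤ fromℤ j
  fromℤ-mono-≤ {i} {j} i≤j = *≤* (subst₂ ℤ._≤_ (sym (ℤ.*-identityʳ i)) (sym (ℤ.*-identityʳ j)) i≤j)

  fromℤ-cancel-≤ : ∀ {i j} → fromℤ i ≤ fromℤ j → i ℤ.≤ j
  fromℤ-cancel-≤ {i} {j} (*≤* i≤j) = subst₂ ℤ._≤_ (ℤ.*-identityʳ i) (ℤ.*-identityʳ j) i≤j

  fromℤ-mono-< : ∀ {i j} → i ℤ.< j → fromℤ i < fromℤ j
  fromℤ-mono-< {i} {j} i<j = *<* (subst₂ ℤ._<_ (sym (ℤ.*-identityʳ i)) (sym (ℤ.*-identityʳ j)) i<j)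

  fromℤ-cancel-< : ∀ {i j} → fromℤ i < fromℤ j → i ℤ.< j
  fromℤ-cancel-< {i} {j} (*<* i<j) = subst₂ ℤ._<_ (ℤ.*-identityʳ i) (ℤ.*-identityʳ j) i<j

  *-cancelʳ-≡-pos : ∀ {p q} r → 0ℚ < r → p * r ≡ q * r → p ≡ q
  *-cancelʳ-≡-pos r r>0 pr≡qr = ≤-antisym (cancel (≤-reflexive pr≡qr)) (cancel (≤-reflexive (sym pr≡qr)))
    where
    cancel : ∀ {p q} → p * r ≤ q * r → p ≤ q
    cancel = *-cancelʳ-≤-pos r {{positive r>0}}

  /-scale : ∀ n d {e m : ℤ} .{{_ : ℕ.NonZero d}} → ℤ.+ n ℤ.* e ≡ m ℤ.* ℤ.+ d →
    (ℤ.+ n / d) * fromℤ e ≡ fromℤ m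
  /-scale n (suc d-1) {e} {m} ne≡md = toℚᵘ-injective (ℚᵘ.≃-trans
    (toℚᵘ-homo-* (ℤ.+ n / suc d-1) (fromℤ e))
    (ℚᵘ.≃-trans (ℚᵘ.*-congʳ (toℚᵘ-fromℚᵘ (ℚᵘ.mkℚᵘ (ℤ.+ n) d-1))) (ℚᵘ.*≡* (begin
      ℤ.+ n ℤ.* e ℤ.* ℤ.+ 1      ≡⟨ ℤ.*-identityʳ _ ⟩
      ℤ.+ n ℤ.* e                ≡⟨ ne≡md ⟩
      m ℤ.* ℤ.+ suc d-1          ≡⟨ cong (λ d → m ℤ.* ℤ.+ d) (ℕ.*-identityʳ (suc d-1)) ⟨
      m ℤ.* ℤ.+ (suc d-1 ℕ.* 1)  ∎))))

  ℚ-ring : AlmostCommutativeRing 0ℓ 0ℓ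
  ℚ-ring = fromCommutativeRing +-*-commutativeRing (λ _ → nothing)

  exchange-scaled : ∀ a b c k u v w {p q s} → k * u ≡ v * w → b * v ≡ p → c * w ≡ q → a * u ≡ s →
    ((b * c) * k - a) * u ≡ p * q - s
  exchange-scaled a b c k u v w {p} {q} {s} ku≡vw bv≡p cw≡q au≡s = begin
    ((b * c) * k - a) * u      ≡⟨ RS.solve (a ∷ b ∷ c ∷ k ∷ u ∷ []) ℚ-ring ⟩
    (b * c) * (k * u) - a * u  ≡⟨ cong₂ (λ t s → (b * c) * t - s) ku≡vw au≡s ⟩
    (b * c) * (v * w) - s      ≡⟨ RS.solve (b ∷ c ∷ v ∷ w ∷ s ∷ []) ℚ-ring ⟩
    (b * v) * (c * w) - s      ≡⟨ cong₂ (λ t t′ → t * t′ - s) bv≡p cw≡q ⟩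
    p * q - s                  ∎

  lift-exchange : ∀ a b c k (U V W : ℤ) {A B C} → k * fromℤ U ≡ fromℤ (V ℤ.* W) →
    b * fromℤ V ≡ fromℤ B → c * fromℤ W ≡ fromℤ C → a * fromℤ U ≡ fromℤ A →
    ((b * c) * k - a) * fromℤ U ≡ fromℤ (B ℤ.* C ℤ.- A)
  lift-exchange a b c k U V W {A} {B} {C} kU≡VW bV≡B cW≡C aU≡A = begin
    ((b * c) * k - a) * fromℤ U   ≡⟨ exchange-scaled a b c k (fromℤ U) (fromℤ V) (fromℤ W)
                                       (trans kU≡VW (fromℤ-homo-* V W)) bV≡B cW≡C aU≡A ⟩
    fromℤ B * fromℤ C - fromℤ A   ≡⟨ cong (_- fromℤ A) (fromℤ-homo-* B C) ⟨
    fromℤ (B ℤ.* C) - fromℤ A     ≡⟨ fromℤ-homo-minus (B ℤ.* C) A ⟨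
    fromℤ (B ℤ.* C ℤ.- A)         ∎

open Embedding

coeff : Fin 3 → Triple → ℚ
coeff 0F (α , _ , _) = α
coeff 1F (_ , β , _) = β
coeff 2F (_ , _ , δ) = δ

coeff-ext : ∀ {T T′} → (∀ i → coeff i T ≡ coeff i T′) → T ≡ T′
coeff-ext {_ , _ , _} {_ , _ , _} eq = cong₂ _,_ (eq 0F) (cong₂ _,_ (eq 1F) (eq 2F))

module Lift (M : Mat) where

  open Mat M
  import Data.Integer as ℤ
  import Data.Integer.Properties as ℤ
  open import Data.Rational using (0ℚ; _*_; _≤_; _<_; positive; nonNegative)
  open import Data.Rational.Literals using (fromℤ)
  import Data.Rational.Properties as ℚ

  M₀ : Matrix
  M₀ = matrix (+ x) (+ y) (+ z) (+ x') (+ y') (+ z')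

  M₀-positive : EntriesPositive M₀
  M₀-positive 0F = +<+ x-pos , +<+ x'-pos
  M₀-positive 1F = +<+ y-pos , +<+ y'-pos
  M₀-positive 2F = +<+ z-pos , +<+ z'-pos

  xyz≡ : + (x ℕ.* y ℕ.* z) ≡ + x ℤ.* + y ℤ.* + z
  xyz≡ = trans (ℤ.pos-* (x ℕ.* y) z) (cong (ℤ._* + z) (ℤ.pos-* x y))

  x'y'z'≡ : + (x' ℕ.* y' ℕ.* z') ≡ + x' ℤ.* + y' ℤ.* + z'
  x'y'z'≡ = trans (ℤ.pos-* (x' ℕ.* y') z') (cong (ℤ._* + z') (ℤ.pos-* x' y'))

  M₀-balanced : Balanced M₀
  M₀-balanced = trans (sym xyz≡) (trans (cong +_ balanced) x'y'z'≡)

  quotient-scales : ∀ i d .{{_ : ℕ.NonZero d}} → + d ≡ norm i M₀ →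
    (+ (x ℕ.* y ℕ.* z) / d) * fromℤ (entry i M₀) ≡ fromℤ (partner i M₀) ×
    (+ (x ℕ.* y ℕ.* z) / d) * fromℤ (entry' i M₀) ≡ fromℤ (partner' i M₀)
  quotient-scales i d d≡norm =
    /-scale (x ℕ.* y ℕ.* z) d (subst₂ (λ K n → K ℤ.* entry i M₀ ≡ partner i M₀ ℤ.* n)
      (sym xyz≡) (sym d≡norm) (product-entry i M₀-balanced)) ,
    /-scale (x ℕ.* y ℕ.* z) d (subst₂ (λ K n → K ℤ.* entry' i M₀ ≡ partner' i M₀ ℤ.* n)
      (sym xyz≡) (sym d≡norm) (product-entry' i M₀))

  k : Fin 3 → ℚ
  k 0F = kA M
  k 1F = kB M
  k 2F = kC M

  nonZero : ∀ {m n} → 0 ℕ.< m → 0 ℕ.< n → ℕ.NonZero (m ℕ.* n)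
  nonZero {m} {n} m>0 n>0 = ℕ.m*n≢0 m n {{ℕ.>-nonZero m>0}} {{ℕ.>-nonZero n>0}}

  k-scales : ∀ i → k i * fromℤ (entry i M₀) ≡ fromℤ (partner i M₀) ×
                   k i * fromℤ (entry' i M₀) ≡ fromℤ (partner' i M₀)
  k-scales 0F = quotient-scales 0F (x ℕ.* x') {{nonZero x-pos x'-pos}} (ℤ.pos-* x x')
  k-scales 1F = quotient-scales 1F (y ℕ.* y') {{nonZero y-pos y'-pos}} (ℤ.pos-* y y')
  k-scales 2F = quotient-scales 2F (z ℕ.* z') {{nonZero z-pos z'-pos}} (ℤ.pos-* z z')

  -- N lifts the coefficient triple T when N is M₀ with its columns scaled by the coefficients of T;
  -- then Sk N is the real triple that T encodes.
  Lifts : Triple → Matrix → Set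
  Lifts T N = ∀ i → coeff i T * fromℤ (entry i M₀) ≡ fromℤ (entry i N) ×
                    coeff i T * fromℤ (entry' i M₀) ≡ fromℤ (entry' i N)

  lifts-mutated : ∀ T {N} → Lifts T N → ∀ i →
    coeff i (γ M i T) * fromℤ (entry i M₀) ≡ fromℤ (entry i (mutate i N)) ×
    coeff i (γ M i T) * fromℤ (entry' i M₀) ≡ fromℤ (entry' i (mutate i N))
  lifts-mutated (α , β , δ) L 0F =
    lift-exchange α β δ (k 0F) (+ x) (+ y') (+ z')
      (proj₁ (k-scales 0F)) (proj₂ (L 1F)) (proj₂ (L 2F)) (proj₁ (L 0F)) ,
    lift-exchange α β δ (k 0F) (+ x') (+ y) (+ z)
      (proj₂ (k-scales 0F)) (proj₁ (L 1F)) (proj₁ (L 2F)) (proj₂ (L 0F))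
  lifts-mutated (α , β , δ) L 1F =
    lift-exchange β δ α (k 1F) (+ y) (+ z') (+ x')
      (proj₁ (k-scales 1F)) (proj₂ (L 2F)) (proj₂ (L 0F)) (proj₁ (L 1F)) ,
    lift-exchange β δ α (k 1F) (+ y') (+ z) (+ x)
      (proj₂ (k-scales 1F)) (proj₁ (L 2F)) (proj₁ (L 0F)) (proj₂ (L 1F))
  lifts-mutated (α , β , δ) L 2F =
    lift-exchange δ α β (k 2F) (+ z) (+ x') (+ y')
      (proj₁ (k-scales 2F)) (proj₂ (L 0F)) (proj₂ (L 1F)) (proj₁ (L 2F)) ,
    lift-exchange δ α β (k 2F) (+ z') (+ x) (+ y)
      (proj₂ (k-scales 2F)) (proj₁ (L 0F)) (proj₁ (L 1F)) (proj₂ (L 2F))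

  lifts-γ : ∀ T {N} → Lifts T N → ∀ i → Lifts (γ M i T) (mutate i N)
  lifts-γ T           L 0F 0F = lifts-mutated T L 0F
  lifts-γ (_ , _ , _) L 0F 1F = L 1F
  lifts-γ (_ , _ , _) L 0F 2F = L 2F
  lifts-γ (_ , _ , _) L 1F 0F = L 0F
  lifts-γ T           L 1F 1F = lifts-mutated T L 1F
  lifts-γ (_ , _ , _) L 1F 2F = L 2F
  lifts-γ (_ , _ , _) L 2F 0F = L 0F
  lifts-γ (_ , _ , _) L 2F 1F = L 1F
  lifts-γ T           L 2F 2F = lifts-mutated T L 2F

  lifts-Sk : Lifts (Sk M) M₀
  lifts-Sk 0F = ℚ.*-identityˡ _ , ℚ.*-identityˡ _
  lifts-Sk 1F = ℚ.*-identityˡ _ , ℚ.*-identityˡ _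
  lifts-Sk 2F = ℚ.*-identityˡ _ , ℚ.*-identityˡ _

  lifts-along : ∀ w → Lifts (apply M w (Sk M)) (act w M₀)
  lifts-along w = go w (Sk M) M₀ lifts-Sk
    where
    go : ∀ w T N → Lifts T N → Lifts (apply M w T) (act w N)
    go []      T N L = L
    go (i ∷ w) T N L = go w (γ M i T) (mutate i N) (lifts-γ T L i)

  row-positive : ∀ i → 0ℚ < fromℤ (entry i M₀) × 0ℚ < fromℤ (entry' i M₀)
  row-positive i = fromℤ-mono-< (proj₁ (M₀-positive i)) , fromℤ-mono-< (proj₂ (M₀-positive i))

  coeff-positive : ∀ {T} → Positive M T → ∀ i → 0ℚ < coeff i T
  coeff-positive {_ , _ , _} (α>0 , _ , _) 0F = α>0
  coeff-positive {_ , _ , _} (_ , β>0 , _) 1F = β>0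
  coeff-positive {_ , _ , _} (_ , _ , δ>0) 2F = δ>0

  scaled-positive : ∀ {c r e} → 0ℚ < c → 0ℚ < fromℤ r → c * fromℤ r ≡ fromℤ e → 0ℤ ℤ.< e
  scaled-positive {c} {r} c>0 r>0 cr≡e = fromℤ-cancel-< (subst (0ℚ <_) cr≡e
    (ℚ.positive⁻¹ (c * fromℤ r) {{ℚ.pos*pos⇒pos c {{positive c>0}} (fromℤ r) {{positive r>0}}}}))

  positive-lift : ∀ {T N} → Lifts T N → Positive M T → EntriesPositive N
  positive-lift L pos i = scaled-positive (coeff-positive pos i) (proj₁ (row-positive i)) (proj₁ (L i)) ,
                          scaled-positive (coeff-positive pos i) (proj₂ (row-positive i)) (proj₂ (L i))

  ≤ₑ-γ⁺ : ∀ i T → coeff i T ≤ coeff i (γ M i T) → _≤ₑ_ M T (γ M i T)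
  ≤ₑ-γ⁺ 0F (_ , _ , _) h = h , ℚ.≤-refl , ℚ.≤-refl
  ≤ₑ-γ⁺ 1F (_ , _ , _) h = ℚ.≤-refl , h , ℚ.≤-refl
  ≤ₑ-γ⁺ 2F (_ , _ , _) h = ℚ.≤-refl , ℚ.≤-refl , h

  ≤ₑ-γ⁻ : ∀ i T → _≤ₑ_ M T (γ M i T) → coeff i T ≤ coeff i (γ M i T)
  ≤ₑ-γ⁻ 0F (_ , _ , _) (h , _ , _) = h
  ≤ₑ-γ⁻ 1F (_ , _ , _) (_ , h , _) = h
  ≤ₑ-γ⁻ 2F (_ , _ , _) (_ , _ , h) = h

  rises-lift : ∀ {T N} → Lifts T N → ∀ i → coeff i T ≤ coeff i (γ M i T) → Rises i N
  rises-lift {T} L i h = fromℤ-cancel-≤ (subst₂ _≤_ (proj₁ (L i)) (proj₁ (lifts-γ T L i i))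
    (ℚ.*-monoʳ-≤-nonNeg (fromℤ (entry i M₀)) {{nonNegative (ℚ.<⇒≤ (proj₁ (row-positive i)))}} h))

  rises-unlift : ∀ {T N} → Lifts T N → ∀ i → Rises i N → coeff i T ≤ coeff i (γ M i T)
  rises-unlift {T} L i h = ℚ.*-cancelʳ-≤-pos (fromℤ (entry i M₀)) {{positive (proj₁ (row-positive i))}}
    (subst₂ _≤_ (sym (proj₁ (L i))) (sym (proj₁ (lifts-γ T L i i))) (fromℤ-mono-≤ h))

  minimal-lift : ∀ {T N} → Lifts T N → M1 M T → Minimal N
  minimal-lift {T} L m1 i = rises-lift L i (≤ₑ-γ⁻ i T (m1 i))

  minimal-unlift : ∀ {T N} → Lifts T N → Minimal N → M1 M T
  minimal-unlift {T} L min i = ≤ₑ-γ⁺ i T (rises-unlift L i (min i))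

  lifts-injective : ∀ {T T′ N} → Lifts T N → Lifts T′ N → T ≡ T′
  lifts-injective L L′ = coeff-ext λ i →
    *-cancelʳ-≡-pos (fromℤ (entry i M₀)) (proj₁ (row-positive i)) (trans (proj₁ (L i)) (sym (proj₁ (L′ i))))

  orbit-positive : ClusterPositive M (Sk M) → OrbitPositive M₀
  orbit-positive (_ , cp) w with reduce w M₀
  ... | w′ , reduced , path =
    subst EntriesPositive path (positive-lift (lifts-along w′) (cp _ (w′ , reduced , refl)))

proposition9p3 : (M : Mat) → ClusterPositive M (Sk M) → PropertyA M (Sk M)
proposition9p3 M cp =
  let w , reduced , min = minimal-reachable pos
  in apply M w (Sk M) , ((w , reduced , refl) , minimal-unlift (lifts-along w) min) , unique w min
  where
  open Lift M

  pos : OrbitPositive M₀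
  pos = orbit-positive cp

  unique : ∀ w → Minimal (act w M₀) → ∀ T → _∈Γ_ M T (Sk M) → M1 M T → T ≡ apply M w (Sk M)
  unique w min _ (v , _ , refl) m1 =
    lifts-injective (lifts-along v) (subst (Lifts (apply M w (Sk M))) same (lifts-along w))
    where
    same : act w M₀ ≡ act v M₀
    same = minimal-unique w v M₀-balanced pos min (minimal-lift (lifts-along v) m1)
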